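{- $\lambda_1^1(C_{10} \times C_{10})=4$.
   Context: For a graph $G$, an $L(1,1)$-labeling with labels in $\{0,1,\dots,p\}$ is a function $l:V(G)\to\{0,1,\dots,p\}$ such that $l(u)\neq l(v)$ whenever the distance $d(u,v)$ is $1$ or $2$. $\lambda_1^1(G)$ denotes the least $p$ for which $G$ admits such a labeling. $C_n$ denotes the cycle with $n$ vertices. The direct product $G\times H$ has vertex set $V(G)\times V(H)$, with $(x_1,x_2)$ adjacent to $(y_1,y_2)$ iff $x_1y_1\in E(G)$ and $x_2y_2\in E(H)$. -}

module Defs where

open import Data.Nat using (ℕ; suc; _≤_)
open import Data.Fin using (Fin; toℕ)
open import Data.Product using (Σ; ∃; _×_; _,_)
open import Data.Sum using (_⊎_)
open import Relation.Binary.PropositionalEquality using (_≡_; _≢_)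

record Graph : Set₁ where
  field
    V   : Set
    Adj : V → V → Set
open Graph public

-- The cycle C_n on vertices 0,…,n-1: i ~ j iff j ≡ i+1 (mod n) or i ≡ j+1 (mod n).
-- (Intended for n ≥ 3, where this is the usual simple cycle.)
succMod : ∀ {n} → Fin (suc n) → Fin (suc n)
succMod {n} i = Data.Fin.fromℕ< (Data.Nat.DivMod.m%n<n (suc (toℕ i)) (suc n))
  where import Data.Nat.DivMod

C : ℕ → Graph
C 0       = record { V = Fin 0 ; Adj = λ _ _ → Fin 0 }
C (suc n) = record { V = Fin (suc n)
                   ; Adj = λ i j → (j ≡ succMod i) ⊎ (i ≡ succMod j) }

-- Direct (tensor/categorical) product G × H.
_×ᵍ_ : Graph → Graph → Graph
G ×ᵍ H = record { V = V G × V H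
                ; Adj = λ { (x₁ , x₂) (y₁ , y₂) → Adj G x₁ y₁ × Adj H x₂ y₂ } }

Dist12 : (G : Graph) → V G → V G → Set
Dist12 G u v = u ≢ v × (Adj G u v ⊎ ∃ λ w → Adj G u w × Adj G w v)

IsL11Labeling : (G : Graph) (p : ℕ) → (V G → Fin (suc p)) → Set
IsL11Labeling G p l = ∀ u v → Dist12 G u v → l u ≢ l v

HasL11Labeling : Graph → ℕ → Set
HasL11Labeling G p = Σ (V G → Fin (suc p)) (IsL11Labeling G p)

λ11≡ : Graph → ℕ → Set
λ11≡ G k = HasL11Labeling G k × (∀ p → HasL11Labeling G p → k ≤ p)

-- A vertex c and its neighbours are pairwise at distance 1 or 2, so they need distinct
-- labels: λ₁¹ is at least the maximum degree, which is 4 at every vertex (a ± 1, b ± 1)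
-- of C₁₀ × C₁₀.  Conversely, two vertices at distance 1 or 2 lie in a common closed
-- neighbourhood, so a labelling injective on every closed neighbourhood is an
-- L(1,1)-labelling.  The labelling (a , b) ↦ a + 2b mod 5 is compatible with the
-- reduction mod 10 (as 5 ∣ 10), and the four neighbour moves shift it by 3, -1, 1, -3,
-- so every closed neighbourhood receives all five labels.
module Submission where

open import Defs
open import Data.Nat using (ℕ; zero; suc; _+_; _*_; _≤_; s≤s)
open import Data.Nat.Properties using (≤-pred)
open import Data.Nat.DivMod using (_%_; _mod_; n%n≡0; m<n⇒m%n≡m)
open import Data.Fin using (Fin; zero; suc; toℕ; combine; remQuot; fromℕ; inject₁)
open import Data.Fin.Properties using (_≟_; all?; injective⇒≤; suc-injective; remQuot-combine; combine-remQuot;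
  toℕ-injective; toℕ-fromℕ<; toℕ-fromℕ; toℕ-inject₁; toℕ<n)
open import Data.Vec.Functional using (Vector; []; _∷_)
open import Data.Product using (_×_; _,_; ∃; proj₁; proj₂; uncurry)
import Data.Product as Product
open import Data.Sum using (_⊎_; inj₁; inj₂)
import Data.Sum as Sum
open import Function using (_∘_)
open import Function.Definitions using (Injective)
open import Relation.Binary.Definitions using (Symmetric)
open import Relation.Nullary using (Dec; yes; no; contradiction)
open import Relation.Nullary.Decidable using (toWitness; map′; _→-dec_)
open import Relation.Binary.PropositionalEquality using (_≡_; _≢_; refl; sym; cong; cong₂; module ≡-Reasoning)


private
  variable
    k m p : ℕ
    G : Graph

injective? : (f : Fin m → Fin k) → Dec (Injective _≡_ _≡_ f)
injective? f = map′ (λ inj {i} {j} → inj i j) (λ inj i j → inj)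
                    (all? λ i → all? λ j → f i ≟ f j →-dec i ≟ j)

_⊗_ : {A B : Set} → Vector A m → Vector B k → Vector (A × B) (m * k)
_⊗_ {k = k} f g = Product.map f g ∘ remQuot k

⊗-combine : {A B : Set} (f : Vector A m) (g : Vector B k) (i : Fin m) (j : Fin k) →
            (f ⊗ g) (combine i j) ≡ (f i , g j)
⊗-combine f g i j = cong (Product.map f g) (remQuot-combine i j)

⊗-injective : {A B : Set} {f : Vector A m} {g : Vector B k} →
              Injective _≡_ _≡_ f → Injective _≡_ _≡_ g → Injective _≡_ _≡_ (f ⊗ g)
⊗-injective {m = m} {k = k} f-inj g-inj {s} {t} eq = begin
  s                                 ≡⟨ combine-remQuot {m} k s ⟨
  uncurry combine (remQuot {m} k s) ≡⟨ cong (uncurry combine) remQuot-s≡remQuot-t ⟩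
  uncurry combine (remQuot {m} k t) ≡⟨ combine-remQuot {m} k t ⟩
  t                                 ∎
  where
  open ≡-Reasoning
  remQuot-s≡remQuot-t : remQuot {m} k s ≡ remQuot k t
  remQuot-s≡remQuot-t = cong₂ _,_ (f-inj (cong proj₁ eq)) (g-inj (cong proj₂ eq))

predMod : ∀ {n} → Fin (suc n) → Fin (suc n)
predMod {n} zero    = fromℕ n
predMod     (suc i) = inject₁ i

fromℕ-or-inject₁ : ∀ {n} (i : Fin (suc n)) → i ≡ fromℕ n ⊎ ∃ λ j → i ≡ inject₁ j
fromℕ-or-inject₁ {zero}  zero    = inj₁ refl
fromℕ-or-inject₁ {suc n} zero    = inj₂ (zero , refl)
fromℕ-or-inject₁ {suc n} (suc i) with fromℕ-or-inject₁ i
... | inj₁ i≡fromℕ    = inj₁ (cong suc i≡fromℕ)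
... | inj₂ (j , i≡j) = inj₂ (suc j , cong suc i≡j)

succMod-fromℕ : ∀ n → succMod (fromℕ n) ≡ zero
succMod-fromℕ n = toℕ-injective (begin
  toℕ (succMod (fromℕ n))    ≡⟨ toℕ-fromℕ< _ ⟩
  suc (toℕ (fromℕ n)) % suc n ≡⟨ cong (λ x → suc x % suc n) (toℕ-fromℕ n) ⟩
  suc n % suc n               ≡⟨ n%n≡0 (suc n) ⟩
  0                           ∎)
  where open ≡-Reasoning

succMod-inject₁ : ∀ {n} (i : Fin n) → succMod (inject₁ i) ≡ suc i
succMod-inject₁ {n} i = toℕ-injective (begin
  toℕ (succMod (inject₁ i))    ≡⟨ toℕ-fromℕ< _ ⟩
  suc (toℕ (inject₁ i)) % suc n ≡⟨ cong (λ x → suc x % suc n) (toℕ-inject₁ i) ⟩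
  suc (toℕ i) % suc n           ≡⟨ m<n⇒m%n≡m (s≤s (toℕ<n i)) ⟩
  suc (toℕ i)                   ∎)
  where open ≡-Reasoning

predMod-succMod : ∀ {n} (i : Fin (suc n)) → predMod (succMod i) ≡ i
predMod-succMod {n} i with fromℕ-or-inject₁ i
... | inj₁ refl       = cong predMod (succMod-fromℕ n)
... | inj₂ (j , refl) = cong predMod (succMod-inject₁ j)

Enumerates : (G : Graph) → (V G → Vector (V G) k) → Set
Enumerates G nb = ∀ {w u} → Adj G w u → ∃ λ i → nb w i ≡ u

L11-if-injective-on-closed-neighbourhoods :
  Symmetric (Adj G) → (nb : V G → Vector (V G) k) → Enumerates G nb →
  (l : V G → Fin (suc p)) → (∀ w → Injective _≡_ _≡_ (l ∘ (w ∷ nb w))) →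
  IsL11Labeling G p l
L11-if-injective-on-closed-neighbourhoods _ nb enum l inj u v (u≢v , inj₁ u~v) lu≡lv
  with enum u~v
... | i , refl = contradiction (inj u {zero} {suc i} lu≡lv) λ ()
L11-if-injective-on-closed-neighbourhoods ~-sym nb enum l inj u v (u≢v , inj₂ (w , u~w , w~v)) lu≡lv
  with enum (~-sym u~w) | enum w~v
... | i , refl | j , refl = u≢v (cong (nb w) (suc-injective (inj w {suc i} {suc j} lu≡lv)))

record Star (G : Graph) (c : V G) (m : ℕ) : Set where
  field
    leaf           : Vector (V G) m
    leaf-injective : Injective _≡_ _≡_ leaf
    centre~leaf    : ∀ i → Adj G c (leaf i)
    centre≢leaf    : ∀ i → c ≢ leaf i

star⇒degree≤λ11 : Symmetric (Adj G) → ∀ {c} → Star G c m → HasL11Labeling G p → m ≤ p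
star⇒degree≤λ11 {G = G} ~-sym {c} star (l , isL11) = ≤-pred (injective⇒≤ l∘N[c]-injective)
  where
  open Star star

  N[c]-dist12 : ∀ {i j} → i ≢ j → Dist12 G ((c ∷ leaf) i) ((c ∷ leaf) j)
  N[c]-dist12 {zero}  {zero}  i≢j = contradiction refl i≢j
  N[c]-dist12 {zero}  {suc j} _   = centre≢leaf j , inj₁ (centre~leaf j)
  N[c]-dist12 {suc i} {zero}  _   = centre≢leaf i ∘ sym , inj₁ (~-sym (centre~leaf i))
  N[c]-dist12 {suc i} {suc j} i≢j =
    i≢j ∘ cong suc ∘ leaf-injective , inj₂ (c , ~-sym (centre~leaf i) , centre~leaf j)

  l∘N[c]-injective : Injective _≡_ _≡_ (l ∘ (c ∷ leaf))
  l∘N[c]-injective {i} {j} li≡lj with i ≟ j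
  ... | yes i≡j = i≡j
  ... | no  i≢j = contradiction li≡lj (isL11 _ _ (N[c]-dist12 i≢j))

×ᵍ-symmetric : {H : Graph} → Symmetric (Adj G) → Symmetric (Adj H) → Symmetric (Adj (G ×ᵍ H))
×ᵍ-symmetric symG symH (x~y , x′~y′) = symG x~y , symH x′~y′

×ᵍ-enumerates : {H : Graph} {nbG : V G → Vector (V G) m} {nbH : V H → Vector (V H) k} →
  Enumerates G nbG → Enumerates H nbH → Enumerates (G ×ᵍ H) (λ (x , y) → nbG x ⊗ nbH y)
×ᵍ-enumerates {nbG = nbG} {nbH} enumG enumH (x~x′ , y~y′) with enumG x~x′ | enumH y~y′
... | i , refl | j , refl = combine i j , ⊗-combine (nbG _) (nbH _) i j

×ᵍ-star : {H : Graph} {x : V G} {y : V H} → Star G x m → Star H y k → Star (G ×ᵍ H) (x , y) (m * k)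
×ᵍ-star sG sH = record
  { leaf           = G.leaf ⊗ H.leaf
  ; leaf-injective = ⊗-injective G.leaf-injective H.leaf-injective
  ; centre~leaf    = λ _ → G.centre~leaf _ , H.centre~leaf _
  ; centre≢leaf    = λ _ → G.centre≢leaf _ ∘ cong proj₁
  }
  where
  module G = Star sG
  module H = Star sH

C-symmetric : ∀ n → Symmetric (Adj (C n))
C-symmetric zero    ()
C-symmetric (suc n) = Sum.swap

cycleNeighbours : ∀ {n} → Fin (suc n) → Vector (Fin (suc n)) 2
cycleNeighbours w = succMod w ∷ predMod w ∷ []

C-enumerates : ∀ n → Enumerates (C (suc n)) cycleNeighbours
C-enumerates n (inj₁ refl) = zero , refl
C-enumerates n (inj₂ refl) = suc zero , predMod-succMod _

C-star : ∀ n → Star (C (3 + n)) zero 2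
C-star n = record
  { leaf           = cycleNeighbours zero
  ; leaf-injective = λ { {zero} {zero} _ → refl ; {suc zero} {suc zero} _ → refl
                       ; {zero} {suc zero} () ; {suc zero} {zero} () }
  ; centre~leaf    = λ { zero → inj₁ refl ; (suc zero) → inj₂ (sym (succMod-fromℕ (2 + n))) }
  ; centre≢leaf    = λ { zero () ; (suc zero) () }
  }

label : Fin 10 × Fin 10 → Fin 5
label (a , b) = (toℕ a + 2 * toℕ b) mod 5

torusNeighbours : Fin 10 × Fin 10 → Vector (Fin 10 × Fin 10) 4
torusNeighbours (a , b) = cycleNeighbours a ⊗ cycleNeighbours b

label-injective-on-closed-neighbourhoods :
  ∀ w → Injective _≡_ _≡_ (label ∘ (w ∷ torusNeighbours w))
label-injective-on-closed-neighbourhoods (a , b) = toWitness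
  {a? = all? λ a → all? λ b → injective? (label ∘ ((a , b) ∷ torusNeighbours (a , b)))} _ a b

torus-symmetric : Symmetric (Adj (C 10 ×ᵍ C 10))
torus-symmetric = ×ᵍ-symmetric {G = C 10} {H = C 10} (C-symmetric 10) (C-symmetric 10)

torus-enumerates : Enumerates (C 10 ×ᵍ C 10) torusNeighbours
torus-enumerates = ×ᵍ-enumerates {G = C 10} {H = C 10} (C-enumerates 9) (C-enumerates 9)

mainTheorem5 : λ11≡ (C 10 ×ᵍ C 10) 4
mainTheorem5 = (label , label-isL11) , λ _ → star⇒degree≤λ11 torus-symmetric torus-star
  where
  label-isL11 : IsL11Labeling (C 10 ×ᵍ C 10) 4 label
  label-isL11 = L11-if-injective-on-closed-neighbourhoods torus-symmetric torusNeighbours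
                  torus-enumerates label label-injective-on-closed-neighbourhoods

  torus-star : Star (C 10 ×ᵍ C 10) (zero , zero) 4
  torus-star = ×ᵍ-star (C-star 7) (C-star 7)
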